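{- Let $(M,\leq,C_i,R_j)_{i,j}$ be a structure in which $\le$ is a linear order, each $C_i$ is a unary predicate and each $R_j$ is a monotone binary relation. Assume that every $\emptyset$-definable subset of $M$ equals some $C_i$ and every monotone $\emptyset$-definable binary relation equals some $R_j$. Then the theory of this structure eliminates quantifiers.
   Context: A binary relation $R$ on a linear order $(M,\le)$ is monotone if $x_1\le x$, $xRy$ and $y\le y_1$ imply $x_1Ry_1$. -}

module Defs where

open import Data.Nat using (ℕ; suc)
open import Data.Fin using (Fin; zero; suc)
open import Data.Product using (Σ; ∃; _×_; _,_)
open import Data.Sum using (_⊎_)
open import Data.Empty using (⊥)
open import Relation.Binary.PropositionalEquality using (_≡_)
open import Relation.Binary.Structures using (IsTotalOrder)
open import Function.Bundles using (_⇔_)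

-- First-order formulas (de Bruijn, n free variables) in the relational
-- language  { = , ≤ , C_i (i : I) , R_j (j : J) }.  No function/constant symbols.
data Formula (I J : Set) : ℕ → Set where
  ⊥f   : ∀ {n} → Formula I J n
  _≐_  : ∀ {n} → Fin n → Fin n → Formula I J n
  _≼_  : ∀ {n} → Fin n → Fin n → Formula I J n
  Cf   : ∀ {n} → I → Fin n → Formula I J n
  Rf   : ∀ {n} → J → Fin n → Fin n → Formula I J n
  _⇒f_ : ∀ {n} → Formula I J n → Formula I J n → Formula I J n
  _∧f_ : ∀ {n} → Formula I J n → Formula I J n → Formula I J n
  _∨f_ : ∀ {n} → Formula I J n → Formula I J n → Formula I J n
  ∃f   : ∀ {n} → Formula I J (suc n) → Formula I J n
  ∀f   : ∀ {n} → Formula I J (suc n) → Formula I J n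

data QF {I J : Set} : ∀ {n} → Formula I J n → Set where
  qf-⊥ : ∀ {n} → QF (⊥f {n = n})
  qf-≐ : ∀ {n} (x y : Fin n) → QF (x ≐ y)
  qf-≼ : ∀ {n} (x y : Fin n) → QF (x ≼ y)
  qf-C : ∀ {n} i (x : Fin n) → QF (Cf i x)
  qf-R : ∀ {n} j (x y : Fin n) → QF (Rf j x y)
  qf-⇒ : ∀ {n} {φ ψ : Formula I J n} → QF φ → QF ψ → QF (φ ⇒f ψ)
  qf-∧ : ∀ {n} {φ ψ : Formula I J n} → QF φ → QF ψ → QF (φ ∧f ψ)
  qf-∨ : ∀ {n} {φ ψ : Formula I J n} → QF φ → QF ψ → QF (φ ∨f ψ)

Monotone : {M : Set} → (M → M → Set) → (M → M → Set) → Set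
Monotone {M} _≤_ R = ∀ (x₁ x y y₁ : M) → x₁ ≤ x → R x y → y ≤ y₁ → R x₁ y₁

record Structure : Set₁ where
  field
    M       : Set
    _≤_     : M → M → Set
    isTotal : IsTotalOrder _≡_ _≤_
    I J     : Set
    C       : I → M → Set
    R       : J → M → M → Set
    R-mono  : ∀ j → Monotone _≤_ (R j)

module _ (S : Structure) where
  open Structure S

  extend : ∀ {n} → M → (Fin n → M) → Fin (suc n) → M
  extend a ρ zero    = a
  extend a ρ (suc k) = ρ k

  Sat : ∀ {n} → Formula I J n → (Fin n → M) → Set
  Sat ⊥f         ρ = ⊥
  Sat (x ≐ y)    ρ = ρ x ≡ ρ y
  Sat (x ≼ y)    ρ = ρ x ≤ ρ y
  Sat (Cf i x)   ρ = C i (ρ x)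
  Sat (Rf j x y) ρ = R j (ρ x) (ρ y)
  Sat (φ ⇒f ψ)   ρ = Sat φ ρ → Sat ψ ρ
  Sat (φ ∧f ψ)   ρ = Sat φ ρ × Sat ψ ρ
  Sat (φ ∨f ψ)   ρ = Sat φ ρ ⊎ Sat ψ ρ
  Sat (∃f φ)     ρ = Σ M λ a → Sat φ (extend a ρ)
  Sat (∀f φ)     ρ = (a : M) → Sat φ (extend a ρ)

  env1 : M → Fin 1 → M
  env1 a _ = a

  env2 : M → M → Fin 2 → M
  env2 a b zero    = a
  env2 a b (suc _) = b

  DefinableSetsNamed : Set
  DefinableSetsNamed =
    (φ : Formula I J 1) → ∃ λ i → ∀ a → C i a ⇔ Sat φ (env1 a)

  MonotoneDefinableRelsNamed : Set
  MonotoneDefinableRelsNamed =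
    (φ : Formula I J 2) →
    Monotone _≤_ (λ a b → Sat φ (env2 a b)) →
    ∃ λ j → ∀ a b → R j a b ⇔ Sat φ (env2 a b)

  -- Th(S) eliminates quantifiers: every formula is equivalent modulo Th(S)
  -- (i.e. S ⊨ ∀x̄ (φ ↔ ψ)) to a quantifier-free formula.
  EliminatesQuantifiers : Set
  EliminatesQuantifiers =
    ∀ {n} (φ : Formula I J n) →
    ∃ λ (ψ : Formula I J n) → QF ψ × (∀ (ρ : Fin n → M) → Sat φ ρ ⇔ Sat ψ ρ)

module Submission where

-- By induction on formulas it suffices to eliminate one existential quantifier
-- in front of a quantifier-free ψ(x, ȳ).  We bring ψ into a disjunctive normal
-- form over "cells"
--     A(ȳ) ∧ C_i(x) ∧ R_j(x, y_p) ∧ R_k(y_q, x)          (A quantifier-free).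
-- Every literal is a cell: a negated lower bound ¬R_j(x, y) is the upper bound
-- given by the (named) monotone relation (u, x) ↦ ¬R_j(x, u), and conversely.
-- Two cells meet in a disjunction of cells: the down-sets {x | R_j(x, a)} of a
-- linear order are nested, and which of two of them is the smaller one is a
-- named monotone relation between the parameters; dually for up-sets.  Finally
-- ∃x of a cell is A(ȳ) ∧ R_e(y_q, y_p), where e names the monotone relation
-- ∃x (C_i(x) ∧ R_j(x, v) ∧ R_k(u, x)).  Excluded middle is used for the
-- propositional normal forms, the nesting of down-sets and for sentences.

open import Defs
open import Level using (0ℓ)
open import Axiom.ExcludedMiddle using (ExcludedMiddle)
open import Axiom.DoubleNegationElimination using (em⇒dne)
open import Data.Nat using (ℕ; zero; suc)
open import Data.Fin using (Fin; zero; suc)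
open import Data.Product using (Σ; _×_; _,_; proj₁; proj₂)
open import Data.Product.Function.NonDependent.Propositional using (_×-cong_)
open import Data.Product.Function.Dependent.Propositional using ()
  renaming (congˡ to Σ-cong)
open import Data.Sum using (_⊎_; inj₁; inj₂)
open import Data.Sum.Function.Propositional using (_⊎-cong_)
open import Data.Empty using (⊥; ⊥-elim)
open import Relation.Nullary using (¬_; yes; no)
open import Relation.Binary.PropositionalEquality using (_≡_; refl; sym; cong₂)
open import Relation.Binary.Structures using (IsTotalOrder)
open import Function.Base using (_∘_)
open import Function.Bundles using (_⇔_; mk⇔; Equivalence)
open import Function.Properties.Equivalence using ()
  renaming (refl to ⇔-refl; sym to ⇔-sym; trans to ⇔-trans)
open import Function.Properties.Inverse using (↔⇒⇔)
open import Function.Related.Propositional using (module EquationalReasoning)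
open import Function.Related.TypeIsomorphisms
  using (→-cong-⇔; ¬-cong-⇔; ×-comm; ×-distribʳ-⊎; Σ-distribˡ-⊎)

open Equivalence using (to; from)

Π-cong : {A : Set} {P Q : A → Set} → (∀ a → P a ⇔ Q a) → ((a : A) → P a) ⇔ ((a : A) → Q a)
Π-cong e = mk⇔ (λ h a → to (e a) (h a)) (λ h a → from (e a) (h a))

≡⇒⇔ : {A B : Set} → A ≡ B → A ⇔ B
≡⇒⇔ refl = ⇔-refl

module Elimination (em : ExcludedMiddle 0ℓ) (S : Structure)
                   (definableSets : DefinableSetsNamed S)
                   (monotoneRels : MonotoneDefinableRelsNamed S) where
  open Structure S
  open IsTotalOrder isTotal using (total; antisym; reflexive)
    renaming (trans to ≤-trans; refl to ≤-refl)

  F : ℕ → Set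
  F = Formula I J

  Env : ℕ → Set
  Env n = Fin n → M

  ⟦_⟧ : ∀ {n} → F n → Env n → Set
  ⟦_⟧ = Sat S

  ⊤f : ∀ {n} → F n
  ⊤f = ⊥f ⇒f ⊥f

  ¬f : ∀ {n} → F n → F n
  ¬f φ = φ ⇒f ⊥f

  qf-⊤ : ∀ {n} → QF (⊤f {n})
  qf-⊤ = qf-⇒ qf-⊥ qf-⊥

  qf-¬ : ∀ {n} {φ : F n} → QF φ → QF (¬f φ)
  qf-¬ q = qf-⇒ q qf-⊥

  dne : {P : Set} → ¬ ¬ P → P
  dne = em⇒dne em

  ¬¬⇔ : {P : Set} → (¬ ¬ P) ⇔ P
  ¬¬⇔ = mk⇔ dne (λ p ¬p → ¬p p)

  module _ {P Q : Set} where
    ¬⊎⇔ : (¬ (P ⊎ Q)) ⇔ (¬ P × ¬ Q)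
    ¬⊎⇔ = mk⇔ (λ h → h ∘ inj₁ , h ∘ inj₂)
              (λ { (¬p , ¬q) (inj₁ p) → ¬p p ; (¬p , ¬q) (inj₂ q) → ¬q q })

    ×⇔¬⊎¬ : (P × Q) ⇔ (¬ (¬ P ⊎ ¬ Q))
    ×⇔¬⊎¬ = mk⇔ (λ { (p , q) (inj₁ ¬p) → ¬p p ; (p , q) (inj₂ ¬q) → ¬q q })
                (λ h → dne (h ∘ inj₁) , dne (h ∘ inj₂))

    →⇔¬⊎ : (P → Q) ⇔ (¬ P ⊎ Q)
    →⇔¬⊎ = mk⇔ split (λ { (inj₁ ¬p) p → ⊥-elim (¬p p) ; (inj₂ q) _ → q })
      where
      split : (P → Q) → ¬ P ⊎ Q
      split h with em {P}
      ... | yes p = inj₂ (h p)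
      ... | no ¬p = inj₁ ¬p

  ∀⇔¬∃¬ : {P : M → Set} → ((x : M) → P x) ⇔ (¬ Σ M λ x → ¬ P x)
  ∀⇔¬∃¬ = mk⇔ (λ h (x , ¬p) → ¬p (h x)) (λ h x → dne (λ ¬p → h (x , ¬p)))

  setName : F 1 → I
  setName γ = proj₁ (definableSets γ)

  setName-spec : ∀ γ a → C (setName γ) a ⇔ ⟦ γ ⟧ (env1 S a)
  setName-spec γ = proj₂ (definableSets γ)

  MonotoneFormula : F 2 → Set
  MonotoneFormula γ = Monotone _≤_ (λ a b → ⟦ γ ⟧ (env2 S a b))

  relName : (γ : F 2) → MonotoneFormula γ → J
  relName γ mono = proj₁ (monotoneRels γ mono)

  relName-spec : ∀ γ mono a b → R (relName γ mono) a b ⇔ ⟦ γ ⟧ (env2 S a b)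
  relName-spec γ mono = proj₂ (monotoneRels γ mono)

  -- The full set and the full relation, used to fill unused slots of a cell.
  fullSet : I
  fullSet = setName ⊤f

  fullSet-spec : ∀ a → C fullSet a
  fullSet-spec a = from (setName-spec ⊤f a) (λ ())

  fullRel : J
  fullRel = relName ⊤f (λ _ _ _ _ _ t _ → t)

  fullRel-spec : ∀ a b → R fullRel a b
  fullRel-spec a b = from (relName-spec ⊤f _ a b) (λ ())

  setMeet : I → I → I
  setMeet i i' = setName (Cf i zero ∧f Cf i' zero)

  setMeet-spec : ∀ i i' a → C (setMeet i i') a ⇔ (C i a × C i' a)
  setMeet-spec i i' = setName-spec (Cf i zero ∧f Cf i' zero)

  orderRel : J
  orderRel = relName (zero ≼ suc zero) (λ _ _ _ _ x₁≤x x≤y y≤y₁ → ≤-trans x₁≤x (≤-trans x≤y y≤y₁))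

  orderRel-spec : ∀ a b → R orderRel a b ⇔ (a ≤ b)
  orderRel-spec = relName-spec (zero ≼ suc zero) _

  complement : J → J
  complement j = relName (¬f (Rf j (suc zero) zero))
    (λ a' a b b' a'≤a ¬r b≤b' r → ¬r (R-mono j b b' a' a b≤b' r a'≤a))

  complement-spec : ∀ j a b → R (complement j) a b ⇔ (¬ R j b a)
  complement-spec j = relName-spec (¬f (Rf j (suc zero) zero)) _

  DownIncl : J → M → J → M → Set
  DownIncl j a j' b = ∀ z → R j z a → R j' z b

  downIncl : J → J → J
  downIncl j j' = relName (∀f (Rf j zero (suc zero) ⇒f Rf j' zero (suc (suc zero))))
    (λ a' a b b' a'≤a incl b≤b' z r →
       R-mono j' z z b b' ≤-refl (incl z (R-mono j z z a' a ≤-refl r a'≤a)) b≤b')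

  downIncl-spec : ∀ j j' a b → R (downIncl j j') a b ⇔ DownIncl j a j' b
  downIncl-spec j j' = relName-spec (∀f (Rf j zero (suc zero) ⇒f Rf j' zero (suc (suc zero)))) _

  UpIncl : J → M → J → M → Set
  UpIncl k v k' u = ∀ z → R k v z → R k' u z

  upIncl : J → J → J
  upIncl k k' = relName (∀f (Rf k (suc (suc zero)) zero ⇒f Rf k' (suc zero) zero))
    (λ u' u v v' u'≤u incl v≤v' z r →
       R-mono k' u' u z z u'≤u (incl z (R-mono k v v' z z v≤v' r ≤-refl)) ≤-refl)

  upIncl-spec : ∀ k k' u v → R (upIncl k k') u v ⇔ UpIncl k v k' u
  upIncl-spec k k' = relName-spec (∀f (Rf k (suc (suc zero)) zero ⇒f Rf k' (suc zero) zero)) _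

  between : I → J → J → J
  between i j k = relName (∃f (Cf i zero ∧f (Rf j zero (suc (suc zero)) ∧f Rf k (suc zero) zero)))
    (λ u' u v v' u'≤u (x , c , rj , rk) v≤v' →
       x , c , R-mono j x x v v' ≤-refl rj v≤v' , R-mono k u' u x x u'≤u rk ≤-refl)

  between-spec : ∀ i j k u v → R (between i j k) u v ⇔ (Σ M λ x → C i x × R j x v × R k u x)
  between-spec i j k =
    relName-spec (∃f (Cf i zero ∧f (Rf j zero (suc (suc zero)) ∧f Rf k (suc zero) zero))) _

  down-nested : ∀ j j' a b → ¬ DownIncl j a j' b → DownIncl j' b j a
  down-nested j j' a b ¬incl w r' = dne (λ ¬r → ¬incl (below-w ¬r))
    where
    below-w : ¬ R j w a → DownIncl j a j' b
    below-w ¬r z r with total z w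
    ... | inj₁ z≤w = R-mono j' z w b b z≤w r' ≤-refl
    ... | inj₂ w≤z = ⊥-elim (¬r (R-mono j w z a a w≤z r ≤-refl))

  up-nested : ∀ k k' u v → ¬ UpIncl k v k' u → UpIncl k' u k v
  up-nested k k' u v ¬incl w r' = dne (λ ¬r → ¬incl (above-w ¬r))
    where
    above-w : ¬ R k v w → UpIncl k v k' u
    above-w ¬r z r with total w z
    ... | inj₁ w≤z = R-mono k' u u w z ≤-refl r' w≤z
    ... | inj₂ z≤w = ⊥-elim (¬r (R-mono k v v z w ≤-refl r z≤w))

  record Cell (n : ℕ) : Set where
    constructor cell
    field
      guard    : F n
      guard-qf : QF guard
      colour   : I
      below    : J
      belowVar : Fin n
      above    : J
      aboveVar : Fin n

  ⟦_⟧ᶜ : ∀ {n} → Cell n → M → Env n → Set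
  ⟦ cell A _ i j p k q ⟧ᶜ x ρ = ⟦ A ⟧ ρ × C i x × R j x (ρ p) × R k (ρ q) x

  data Tree (n : ℕ) : Set where
    none : Tree n
    leaf : Cell n → Tree n
    _or_ : Tree n → Tree n → Tree n

  ⟦_⟧ᵗ : ∀ {n} → Tree n → M → Env n → Set
  ⟦ none ⟧ᵗ   x ρ = ⊥
  ⟦ leaf c ⟧ᵗ x ρ = ⟦ c ⟧ᶜ x ρ
  ⟦ t or u ⟧ᵗ x ρ = ⟦ t ⟧ᵗ x ρ ⊎ ⟦ u ⟧ᵗ x ρ

  bind : ∀ {n} → (Cell n → Tree n) → Tree n → Tree n
  bind f none     = none
  bind f (leaf c) = f c
  bind f (t or u) = bind f t or bind f u

  bind-spec : ∀ {n} (f : Cell n → Tree n) {P : Set} x ρ →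
              (∀ c → ⟦ f c ⟧ᵗ x ρ ⇔ (⟦ c ⟧ᶜ x ρ × P)) →
              ∀ t → ⟦ bind f t ⟧ᵗ x ρ ⇔ (⟦ t ⟧ᵗ x ρ × P)
  bind-spec f x ρ spec none     = mk⇔ (λ ()) proj₁
  bind-spec f x ρ spec (leaf c) = spec c
  bind-spec f x ρ spec (t or u) =
    ⇔-trans (bind-spec f x ρ spec t ⊎-cong bind-spec f x ρ spec u) (⇔-sym (↔⇒⇔ ×-distribʳ-⊎))

  -- Intersecting a cell with a down-set {x | R_j'(x, y_p')}: keep the smaller one.
  meetBelow : ∀ {n} → Cell n → J → Fin n → Tree n
  meetBelow (cell A qA i j p k q) j' p' =
    leaf (cell (A ∧f smaller) (qf-∧ qA qf-smaller) i j p k q)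
      or leaf (cell (A ∧f ¬f smaller) (qf-∧ qA (qf-¬ qf-smaller)) i j' p' k q)
    where
    smaller = Rf (downIncl j j') p p'
    qf-smaller = qf-R (downIncl j j') p p'

  meetBelow-spec : ∀ {n} (c : Cell n) j' p' x ρ →
                   ⟦ meetBelow c j' p' ⟧ᵗ x ρ ⇔ (⟦ c ⟧ᶜ x ρ × R j' x (ρ p'))
  meetBelow-spec (cell A qA i j p k q) j' p' x ρ = mk⇔ forward backward
    where
    incl = downIncl-spec j j' (ρ p) (ρ p')
    forward : ⟦ meetBelow (cell A qA i j p k q) j' p' ⟧ᵗ x ρ →
              ⟦ cell A qA i j p k q ⟧ᶜ x ρ × R j' x (ρ p')
    forward (inj₁ ((a , s) , c , r , u))  = (a , c , r , u) , to incl s x r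
    forward (inj₂ ((a , ¬s) , c , r' , u)) =
      (a , c , down-nested j j' _ _ (¬s ∘ from incl) x r' , u) , r'
    backward : ⟦ cell A qA i j p k q ⟧ᶜ x ρ × R j' x (ρ p') →
               ⟦ meetBelow (cell A qA i j p k q) j' p' ⟧ᵗ x ρ
    backward ((a , c , r , u) , r') with em {DownIncl j (ρ p) j' (ρ p')}
    ... | yes s = inj₁ ((a , from incl s) , c , r , u)
    ... | no ¬s = inj₂ ((a , ¬s ∘ to incl) , c , r' , u)

  -- Intersecting a cell with an up-set {x | R_k'(y_q', x)}: keep the smaller one.
  meetAbove : ∀ {n} → Cell n → J → Fin n → Tree n
  meetAbove (cell A qA i j p k q) k' q' =
    leaf (cell (A ∧f smaller) (qf-∧ qA qf-smaller) i j p k q)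
      or leaf (cell (A ∧f ¬f smaller) (qf-∧ qA (qf-¬ qf-smaller)) i j p k' q')
    where
    smaller = Rf (upIncl k k') q' q
    qf-smaller = qf-R (upIncl k k') q' q

  meetAbove-spec : ∀ {n} (c : Cell n) k' q' x ρ →
                   ⟦ meetAbove c k' q' ⟧ᵗ x ρ ⇔ (⟦ c ⟧ᶜ x ρ × R k' (ρ q') x)
  meetAbove-spec (cell A qA i j p k q) k' q' x ρ = mk⇔ forward backward
    where
    incl = upIncl-spec k k' (ρ q') (ρ q)
    forward : ⟦ meetAbove (cell A qA i j p k q) k' q' ⟧ᵗ x ρ →
              ⟦ cell A qA i j p k q ⟧ᶜ x ρ × R k' (ρ q') x
    forward (inj₁ ((a , s) , c , r , u))  = (a , c , r , u) , to incl s x u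
    forward (inj₂ ((a , ¬s) , c , r , u')) =
      (a , c , r , up-nested k k' _ _ (¬s ∘ from incl) x u') , u'
    backward : ⟦ cell A qA i j p k q ⟧ᶜ x ρ × R k' (ρ q') x →
               ⟦ meetAbove (cell A qA i j p k q) k' q' ⟧ᵗ x ρ
    backward ((a , c , r , u) , u') with em {UpIncl k (ρ q) k' (ρ q')}
    ... | yes s = inj₁ ((a , from incl s) , c , r , u)
    ... | no ¬s = inj₂ ((a , ¬s ∘ to incl) , c , r , u')

  restrict : ∀ {n} → Cell n → Cell n → Cell n
  restrict (cell A qA i j p k q) (cell A' qA' i' _ _ _ _) =
    cell (A ∧f A') (qf-∧ qA qA') (setMeet i i') j p k q

  meet : ∀ {n} → Cell n → Cell n → Tree n
  meet c d = bind (λ e → meetAbove e (Cell.above d) (Cell.aboveVar d))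
                  (meetBelow (restrict c d) (Cell.below d) (Cell.belowVar d))

  meet-spec : ∀ {n} (c d : Cell n) x ρ → ⟦ meet c d ⟧ᵗ x ρ ⇔ (⟦ c ⟧ᶜ x ρ × ⟦ d ⟧ᶜ x ρ)
  meet-spec c@(cell A qA i j p k q) d@(cell A' qA' i' j' p' k' q') x ρ =
    begin
      ⟦ meet c d ⟧ᵗ x ρ
        ∼⟨ bind-spec (λ e → meetAbove e k' q') x ρ (λ e → meetAbove-spec e k' q' x ρ)
                     (meetBelow (restrict c d) j' p') ⟩
      (⟦ meetBelow (restrict c d) j' p' ⟧ᵗ x ρ × R k' (ρ q') x)
        ∼⟨ meetBelow-spec (restrict c d) j' p' x ρ ×-cong ⇔-refl ⟩
      ((⟦ restrict c d ⟧ᶜ x ρ × R j' x (ρ p')) × R k' (ρ q') x)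
        ∼⟨ regroup ⟩
      (⟦ c ⟧ᶜ x ρ × ⟦ d ⟧ᶜ x ρ) ∎
    where
    open EquationalReasoning
    colours = setMeet-spec i i' x
    regroup : ((⟦ restrict c d ⟧ᶜ x ρ × R j' x (ρ p')) × R k' (ρ q') x) ⇔ (⟦ c ⟧ᶜ x ρ × ⟦ d ⟧ᶜ x ρ)
    regroup = mk⇔
      (λ { ((((a , a') , col , r , u) , r') , u') →
             (a , proj₁ (to colours col) , r , u) , (a' , proj₂ (to colours col) , r' , u') })
      (λ { ((a , col , r , u) , (a' , col' , r' , u')) →
             (((a , a') , from colours (col , col') , r , u) , r') , u' })

  _and_ : ∀ {n} → Tree n → Tree n → Tree n
  t and u = bind (λ d → bind (λ c → meet c d) u) t

  and-spec : ∀ {n} (t u : Tree n) x ρ → ⟦ t and u ⟧ᵗ x ρ ⇔ (⟦ t ⟧ᵗ x ρ × ⟦ u ⟧ᵗ x ρ)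
  and-spec t u x ρ = bind-spec (λ d → bind (λ c → meet c d) u) x ρ
    (λ d → ⇔-trans (bind-spec (λ c → meet c d) x ρ (λ c → meet-spec c d x ρ) u) (↔⇒⇔ (×-comm _ _))) t

  record NormalForm {n : ℕ} (P : M → Env n → Set) : Set where
    field
      pos      : Tree n
      neg      : Tree n
      pos-spec : ∀ x ρ → P x ρ ⇔ ⟦ pos ⟧ᵗ x ρ
      neg-spec : ∀ x ρ → (¬ P x ρ) ⇔ ⟦ neg ⟧ᵗ x ρ
  open NormalForm

  module _ {n : ℕ} where
    nf-resp : {P Q : M → Env n → Set} → (∀ x ρ → P x ρ ⇔ Q x ρ) → NormalForm P → NormalForm Q
    nf-resp e N = record
      { pos = pos N ; neg = neg N
      ; pos-spec = λ x ρ → ⇔-trans (⇔-sym (e x ρ)) (pos-spec N x ρ)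
      ; neg-spec = λ x ρ → ⇔-trans (¬-cong-⇔ (⇔-sym (e x ρ))) (neg-spec N x ρ) }

    nf-not : {P : M → Env n → Set} → NormalForm P → NormalForm (λ x ρ → ¬ P x ρ)
    nf-not N = record
      { pos = neg N ; neg = pos N
      ; pos-spec = neg-spec N
      ; neg-spec = λ x ρ → ⇔-trans ¬¬⇔ (pos-spec N x ρ) }

    nf-or : {P Q : M → Env n → Set} → NormalForm P → NormalForm Q →
            NormalForm (λ x ρ → P x ρ ⊎ Q x ρ)
    nf-or N N' = record
      { pos = pos N or pos N' ; neg = neg N and neg N'
      ; pos-spec = λ x ρ → pos-spec N x ρ ⊎-cong pos-spec N' x ρ
      ; neg-spec = λ x ρ → ⇔-trans ¬⊎⇔ (⇔-trans (neg-spec N x ρ ×-cong neg-spec N' x ρ)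
                                                (⇔-sym (and-spec (neg N) (neg N') x ρ))) }

    nf-and : {P Q : M → Env n → Set} → NormalForm P → NormalForm Q →
             NormalForm (λ x ρ → P x ρ × Q x ρ)
    nf-and N N' = nf-resp (λ x ρ → ⇔-sym ×⇔¬⊎¬) (nf-not (nf-or (nf-not N) (nf-not N')))

    nf-imp : {P Q : M → Env n → Set} → NormalForm P → NormalForm Q →
             NormalForm (λ x ρ → P x ρ → Q x ρ)
    nf-imp N N' = nf-resp (λ x ρ → ⇔-sym →⇔¬⊎) (nf-or (nf-not N) N')

  -- Literals as single cells; unused slots are filled with full sets and relations,
  -- anchored at the first parameter.
  module _ {m : ℕ} where
    guardCell : (β : F (suc m)) → QF β → Cell (suc m)
    guardCell β qβ = cell β qβ fullSet fullRel zero fullRel zero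

    guardCell-spec : ∀ β qβ x ρ → ⟦ guardCell β qβ ⟧ᶜ x ρ ⇔ ⟦ β ⟧ ρ
    guardCell-spec β qβ x ρ =
      mk⇔ proj₁ (λ b → b , fullSet-spec x , fullRel-spec _ _ , fullRel-spec _ _)

    colourCell : I → Cell (suc m)
    colourCell i = cell ⊤f qf-⊤ i fullRel zero fullRel zero

    colourCell-spec : ∀ i x ρ → ⟦ colourCell i ⟧ᶜ x ρ ⇔ C i x
    colourCell-spec i x ρ =
      mk⇔ (proj₁ ∘ proj₂) (λ c → (λ ()) , c , fullRel-spec _ _ , fullRel-spec _ _)

    belowCell : J → Fin (suc m) → Cell (suc m)
    belowCell j b = cell ⊤f qf-⊤ fullSet j b fullRel zero

    belowCell-spec : ∀ j b x ρ → ⟦ belowCell j b ⟧ᶜ x ρ ⇔ R j x (ρ b)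
    belowCell-spec j b x ρ =
      mk⇔ (proj₁ ∘ proj₂ ∘ proj₂) (λ r → (λ ()) , fullSet-spec x , r , fullRel-spec _ _)

    aboveCell : J → Fin (suc m) → Cell (suc m)
    aboveCell k b = cell ⊤f qf-⊤ fullSet fullRel zero k b

    aboveCell-spec : ∀ k b x ρ → ⟦ aboveCell k b ⟧ᶜ x ρ ⇔ R k (ρ b) x
    aboveCell-spec k b x ρ =
      mk⇔ (proj₂ ∘ proj₂ ∘ proj₂) (λ r → (λ ()) , fullSet-spec x , fullRel-spec _ _ , r)

    nf-guard : (β : F (suc m)) → QF β → NormalForm (λ x ρ → ⟦ β ⟧ ρ)
    nf-guard β qβ = record
      { pos = leaf (guardCell β qβ) ; neg = leaf (guardCell (¬f β) (qf-¬ qβ))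
      ; pos-spec = λ x ρ → ⇔-sym (guardCell-spec β qβ x ρ)
      ; neg-spec = λ x ρ → ⇔-sym (guardCell-spec (¬f β) (qf-¬ qβ) x ρ) }

    nf-unary : (γ : F 1) → NormalForm (λ x (ρ : Env (suc m)) → ⟦ γ ⟧ (env1 S x))
    nf-unary γ = record
      { pos = leaf (colourCell (setName γ)) ; neg = leaf (colourCell (setName (¬f γ)))
      ; pos-spec = λ x ρ → ⇔-sym (⇔-trans (colourCell-spec _ x ρ) (setName-spec γ x))
      ; neg-spec = λ x ρ → ⇔-sym (⇔-trans (colourCell-spec _ x ρ) (setName-spec (¬f γ) x)) }

    nf-below : ∀ j b → NormalForm (λ x ρ → R j x (ρ b))
    nf-below j b = record
      { pos = leaf (belowCell j b) ; neg = leaf (aboveCell (complement j) b)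
      ; pos-spec = λ x ρ → ⇔-sym (belowCell-spec j b x ρ)
      ; neg-spec = λ x ρ → ⇔-sym (⇔-trans (aboveCell-spec _ b x ρ) (complement-spec j _ x)) }

    nf-above : ∀ k b → NormalForm (λ x ρ → R k (ρ b) x)
    nf-above k b = record
      { pos = leaf (aboveCell k b) ; neg = leaf (belowCell (complement k) b)
      ; pos-spec = λ x ρ → ⇔-sym (aboveCell-spec k b x ρ)
      ; neg-spec = λ x ρ → ⇔-sym (⇔-trans (belowCell-spec _ b x ρ) (complement-spec k x _)) }

    nf-≤-below : ∀ b → NormalForm (λ x ρ → x ≤ ρ b)
    nf-≤-below b = nf-resp (λ x ρ → orderRel-spec x _) (nf-below orderRel b)

    nf-≤-above : ∀ b → NormalForm (λ x ρ → ρ b ≤ x)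
    nf-≤-above b = nf-resp (λ x ρ → orderRel-spec _ x) (nf-above orderRel b)

    ≡⇔≤×≥ : ∀ a b → (a ≤ b × b ≤ a) ⇔ (a ≡ b)
    ≡⇔≤×≥ a b = mk⇔ (λ (a≤b , b≤a) → antisym a≤b b≤a) (λ a≡b → reflexive a≡b , reflexive (sym a≡b))

    normalForm : {ψ : F (suc (suc m))} → QF ψ → NormalForm (λ x ρ → ⟦ ψ ⟧ (extend S x ρ))
    normalForm qf-⊥                    = nf-guard ⊥f qf-⊥
    normalForm (qf-≐ zero zero)        = nf-unary (zero ≐ zero)
    normalForm (qf-≐ zero (suc b))     =
      nf-resp (λ x ρ → ≡⇔≤×≥ x (ρ b)) (nf-and (nf-≤-below b) (nf-≤-above b))
    normalForm (qf-≐ (suc a) zero)     =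
      nf-resp (λ x ρ → ≡⇔≤×≥ (ρ a) x) (nf-and (nf-≤-above a) (nf-≤-below a))
    normalForm (qf-≐ (suc a) (suc b))  = nf-guard (a ≐ b) (qf-≐ a b)
    normalForm (qf-≼ zero zero)        = nf-unary (zero ≼ zero)
    normalForm (qf-≼ zero (suc b))     = nf-≤-below b
    normalForm (qf-≼ (suc a) zero)     = nf-≤-above a
    normalForm (qf-≼ (suc a) (suc b))  = nf-guard (a ≼ b) (qf-≼ a b)
    normalForm (qf-C i zero)           = nf-unary (Cf i zero)
    normalForm (qf-C i (suc a))        = nf-guard (Cf i a) (qf-C i a)
    normalForm (qf-R j zero zero)      = nf-unary (Rf j zero zero)
    normalForm (qf-R j zero (suc b))   = nf-below j b
    normalForm (qf-R j (suc a) zero)   = nf-above j a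
    normalForm (qf-R j (suc a) (suc b)) = nf-guard (Rf j a b) (qf-R j a b)
    normalForm (qf-⇒ q q')             = nf-imp (normalForm q) (normalForm q')
    normalForm (qf-∧ q q')             = nf-and (normalForm q) (normalForm q')
    normalForm (qf-∨ q q')             = nf-or (normalForm q) (normalForm q')

  projectCell : ∀ {n} → Cell n → F n
  projectCell (cell A _ i j p k q) = A ∧f Rf (between i j k) q p

  projectCell-spec : ∀ {n} (c : Cell n) ρ → (Σ M λ x → ⟦ c ⟧ᶜ x ρ) ⇔ ⟦ projectCell c ⟧ ρ
  projectCell-spec (cell A _ i j p k q) ρ = mk⇔
    (λ (x , a , c , r , u) → a , from betw (x , c , r , u))
    (λ (a , e) → let (x , c , r , u) = to betw e in x , a , c , r , u)
    where
    betw = between-spec i j k (ρ q) (ρ p)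

  project : ∀ {n} → Tree n → F n
  project none     = ⊥f
  project (leaf c) = projectCell c
  project (t or u) = project t ∨f project u

  project-qf : ∀ {n} (t : Tree n) → QF (project t)
  project-qf none                        = qf-⊥
  project-qf (leaf (cell _ qA i j p k q)) = qf-∧ qA (qf-R (between i j k) q p)
  project-qf (t or u)                    = qf-∨ (project-qf t) (project-qf u)

  project-spec : ∀ {n} (t : Tree n) ρ → (Σ M λ x → ⟦ t ⟧ᵗ x ρ) ⇔ ⟦ project t ⟧ ρ
  project-spec none     ρ = mk⇔ proj₂ (λ ())
  project-spec (leaf c) ρ = projectCell-spec c ρ
  project-spec (t or u) ρ =
    ⇔-trans (↔⇒⇔ Σ-distribˡ-⊎) (project-spec t ρ ⊎-cong project-spec u ρ)

  extend-pointwise : ∀ {n} {ρ σ : Env n} → (∀ v → ρ v ≡ σ v) → ∀ x v → extend S x ρ v ≡ extend S x σ v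
  extend-pointwise e x zero    = refl
  extend-pointwise e x (suc v) = e v

  Sat-pointwise : ∀ {n} (φ : F n) {ρ σ : Env n} → (∀ v → ρ v ≡ σ v) → ⟦ φ ⟧ ρ ⇔ ⟦ φ ⟧ σ
  Sat-pointwise ⊥f         e = ⇔-refl
  Sat-pointwise (x ≐ y)    e = ≡⇒⇔ (cong₂ _≡_ (e x) (e y))
  Sat-pointwise (x ≼ y)    e = ≡⇒⇔ (cong₂ _≤_ (e x) (e y))
  Sat-pointwise (Cf i x)   e = ≡⇒⇔ (cong₂ (λ a _ → C i a) (e x) (e x))
  Sat-pointwise (Rf j x y) e = ≡⇒⇔ (cong₂ (R j) (e x) (e y))
  Sat-pointwise (φ ⇒f ψ)   e = →-cong-⇔ (Sat-pointwise φ e) (Sat-pointwise ψ e)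
  Sat-pointwise (φ ∧f ψ)   e = Sat-pointwise φ e ×-cong Sat-pointwise ψ e
  Sat-pointwise (φ ∨f ψ)   e = Sat-pointwise φ e ⊎-cong Sat-pointwise ψ e
  Sat-pointwise (∃f φ)     e = Σ-cong (λ {x} → Sat-pointwise φ (extend-pointwise e x))
  Sat-pointwise (∀f φ)     e = Π-cong (λ x → Sat-pointwise φ (extend-pointwise e x))

  HasQFEquivalent : ∀ {n} → F n → Set
  HasQFEquivalent {n} φ = Σ (F n) λ ψ → QF ψ × (∀ ρ → ⟦ φ ⟧ ρ ⇔ ⟦ ψ ⟧ ρ)

  decideSentence : (φ : F 0) → HasQFEquivalent φ
  decideSentence φ with em {⟦ φ ⟧ (λ ())}
  ... | yes s = ⊤f , qf-⊤ , λ ρ → mk⇔ (λ _ ()) (λ _ → from (Sat-pointwise φ (λ ())) s)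
  ... | no ¬s = ⊥f , qf-⊥ , λ ρ → mk⇔ (¬s ∘ to (Sat-pointwise φ (λ ()))) (λ ())

  eliminate∃ : ∀ {n} (ψ : F (suc n)) → QF ψ → HasQFEquivalent (∃f ψ)
  eliminate∃ {zero}  ψ qψ = decideSentence (∃f ψ)
  eliminate∃ {suc m} ψ qψ =
    project (pos N) , project-qf (pos N) ,
    λ ρ → ⇔-trans (Σ-cong (λ {x} → pos-spec N x ρ)) (project-spec (pos N) ρ)
    where
    N = normalForm qψ

  eliminate : ∀ {n} (φ : F n) → HasQFEquivalent φ
  eliminate ⊥f         = ⊥f , qf-⊥ , λ ρ → ⇔-refl
  eliminate (x ≐ y)    = x ≐ y , qf-≐ x y , λ ρ → ⇔-refl
  eliminate (x ≼ y)    = x ≼ y , qf-≼ x y , λ ρ → ⇔-refl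
  eliminate (Cf i x)   = Cf i x , qf-C i x , λ ρ → ⇔-refl
  eliminate (Rf j x y) = Rf j x y , qf-R j x y , λ ρ → ⇔-refl
  eliminate (φ ⇒f ψ) with eliminate φ | eliminate ψ
  ... | φ' , q , e | ψ' , q' , e' = φ' ⇒f ψ' , qf-⇒ q q' , λ ρ → →-cong-⇔ (e ρ) (e' ρ)
  eliminate (φ ∧f ψ) with eliminate φ | eliminate ψ
  ... | φ' , q , e | ψ' , q' , e' = φ' ∧f ψ' , qf-∧ q q' , λ ρ → e ρ ×-cong e' ρ
  eliminate (φ ∨f ψ) with eliminate φ | eliminate ψ
  ... | φ' , q , e | ψ' , q' , e' = φ' ∨f ψ' , qf-∨ q q' , λ ρ → e ρ ⊎-cong e' ρ
  eliminate (∃f φ) with eliminate φ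
  ... | ψ , qψ , e with eliminate∃ ψ qψ
  ... | χ , qχ , e' = χ , qχ , λ ρ → ⇔-trans (Σ-cong (λ {x} → e (extend S x ρ))) (e' ρ)
  eliminate (∀f φ) with eliminate φ
  ... | ψ , qψ , e with eliminate∃ (¬f ψ) (qf-¬ qψ)
  ... | χ , qχ , e' = ¬f χ , qf-¬ qχ , λ ρ →
    ⇔-trans (Π-cong (λ x → e (extend S x ρ))) (⇔-trans ∀⇔¬∃¬ (¬-cong-⇔ (e' ρ)))

proposition4p1 : ExcludedMiddle 0ℓ → (S : Structure) →
    DefinableSetsNamed S → MonotoneDefinableRelsNamed S →
    EliminatesQuantifiers S
proposition4p1 em S definableSets monotoneRels =
  Elimination.eliminate em S definableSets monotoneRels
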